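{- Let $d\ge1$ and $q\ge3$ be integers, let $G$ be a connected $K_{1,d}$-free graph without induced cycles of length at least $q$, let $P$ be an induced path in $G$, and let $v\in V(G)\setminus V(P)$. Then there exists a path $P_v\subseteq P$ with at most $2(d-1)(q-2)$ vertices such that $N(v)\cap V(P)\subseteq V(P_v)$ and each endpoint of $P_v$ is adjacent to $v$.
   Context: Graphs are finite and simple; $K_{1,d}$-free means no induced star with $d$ leaves. $N(v)$ is the (open) neighborhood of $v$; $P_v\subseteq P$ means $P_v$ is a subpath of $P$. -}

module Defs where

open import Data.Nat using (ℕ; zero; suc; _+_; _*_; _∸_; _≤_; _<_)
open import Data.Fin using (Fin; toℕ; fromℕ)
open import Data.Product using (Σ; ∃; _×_; _,_)
open import Data.Sum using (_⊎_)
open import Relation.Nullary using (¬_)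
open import Relation.Binary.PropositionalEquality using (_≡_; _≢_)
open import Relation.Binary.Definitions using (Decidable)
open import Function.Definitions using (Injective)
open import Function.Bundles using (_⇔_)

record Graph (n : ℕ) : Set₁ where
  field
    Adj     : Fin n → Fin n → Set
    adj?    : Decidable Adj
    sym     : ∀ {u w} → Adj u w → Adj w u
    irrefl  : ∀ {u} → ¬ Adj u u

open Graph public

module _ {n : ℕ} (G : Graph n) where

  Consec : {k : ℕ} → Fin k → Fin k → Set
  Consec i j = (toℕ j ≡ suc (toℕ i)) ⊎ (toℕ i ≡ suc (toℕ j))

  CycConsec : {k : ℕ} → Fin k → Fin k → Set
  CycConsec {k} i j =
    Consec i j
    ⊎ ((suc (toℕ i) ≡ k × toℕ j ≡ 0) ⊎ (suc (toℕ j) ≡ k × toℕ i ≡ 0))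

  IsInducedPath : (k : ℕ) → (Fin k → Fin n) → Set
  IsInducedPath k P =
    Injective _≡_ _≡_ P × (∀ i j → Adj G (P i) (P j) ⇔ Consec i j)

  IsInducedCycle : (k : ℕ) → (Fin k → Fin n) → Set
  IsInducedCycle k C =
    3 ≤ k × Injective _≡_ _≡_ C × (∀ i j → Adj G (C i) (C j) ⇔ CycConsec i j)

  NoLongInducedHole : ℕ → Set
  NoLongInducedHole q = ∀ k (C : Fin k → Fin n) → q ≤ k → ¬ IsInducedCycle k C

  K1-Free : ℕ → Set
  K1-Free d = ¬ (Σ (Fin n) λ c → Σ (Fin d → Fin n) λ L →
                   Injective _≡_ _≡_ L
                 × (∀ i → Adj G c (L i))
                 × (∀ i j → i ≢ j → ¬ Adj G (L i) (L j)))

  Walk : Fin n → Fin n → Set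
  Walk u w = Σ ℕ λ k → Σ (Fin (suc k) → Fin n) λ W →
               W Fin.zero ≡ u × W (fromℕ k) ≡ w
             × (∀ (i j : Fin (suc k)) → toℕ j ≡ suc (toℕ i) → Adj G (W i) (W j))

  Connected : Set
  Connected = ∀ u w → Walk u w

-- Between two consecutive neighbours of v on P lie at most q − 3 vertices of P: otherwise v and
-- that stretch of P form an induced cycle of length at least q. So from the first neighbour f,
-- jumping twice to the next neighbour advances at most 2(q − 2) positions, and the neighbours
-- reached this way are pairwise at distance at least 2 on P, hence pairwise nonadjacent since P
-- is induced. If the last neighbour l were at least 2(d − 1)(q − 2) beyond f, d such jumps would
-- give an induced K₁,d centred at v; hence the window P f, …, P l has at most 2(d − 1)(q − 2)
-- vertices.
module Submission where

open import Defs
import Data.Nat as ℕ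
open import Data.Nat using (ℕ; zero; suc; _+_; _*_; _∸_; _≤_; _<_; z≤n; s≤s; _≤?_; _<?_)
open import Data.Nat.Properties
  using ( ≤-reflexive; ≤-trans; <-trans; ≤-<-trans; <-≤-trans; <⇒≤; <-irrefl; <-asym
        ; n<1+n; n≤1+n; m<n⇒m<1+n; m≤n⇒m≤1+n; m<1+n⇒m≤n; m<1+n⇒m<n∨m≡n; ≤∧≢⇒<; ≮⇒≥; ≰⇒>
        ; n≢0⇒n>0; m<m+n; m+n≤o⇒m≤o; m≤m+n; +-suc; +-identityʳ; +-cancelˡ-≡; +-cancelˡ-≤
        ; +-monoˡ-≤; +-monoʳ-<
        ; m+[n∸m]≡n; m+n∸m≡n; ∸-monoˡ-≤; suc-injective; _≟_ )
open import Data.Nat.Tactic.RingSolver using (solve-∀)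
open import Data.Fin using (Fin; toℕ; zero; suc; _↑ʳ_; inject≤)
open import Data.Fin.Properties using (toℕ-↑ʳ; toℕ-inject≤; toℕ-injective; toℕ<n; any?)
import Data.Fin.Properties as Finₚ
open import Data.Vec.Functional using (_∷_)
open import Data.Product using (Σ; ∃; _×_; _,_; proj₁; proj₂)
open import Data.Sum using (_⊎_; inj₁; inj₂; [_,_]; swap)
open import Data.Sum.Function.Propositional using (_⊎-⇔_)
open import Data.Empty using (⊥; ⊥-elim)
open import Function using (_∘_)
open import Function.Bundles using (_⇔_; mk⇔; Equivalence)
open import Function.Construct.Composition using (_⇔-∘_)
open import Function.Construct.Symmetry using (⇔-sym)
open import Function.Definitions using (Injective)
open import Relation.Nullary using (¬_; Dec; yes; no)
open import Relation.Nullary.Decidable using (_×-dec_)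
open import Relation.Binary.PropositionalEquality as ≡ using (_≡_; _≢_; refl; cong; subst; trans)

open Equivalence using (to; from)

module _ {Q : ℕ → Set} (Q? : ∀ j → Dec (Q j)) where

  private
    none-below-suc : ∀ {m} → (∀ j → j < m → ¬ Q j) → ¬ Q m → ∀ j → j < suc m → ¬ Q j
    none-below-suc none ¬Qm j j<1+m with m<1+n⇒m<n∨m≡n j<1+m
    ... | inj₁ j<m = none j j<m
    ... | inj₂ refl = ¬Qm

  first-below : ∀ m → (∀ j → j < m → ¬ Q j)
              ⊎ ∃ λ c → Q c × c < m × (∀ j → j < c → ¬ Q j)
  first-below zero = inj₁ λ _ ()
  first-below (suc m) with first-below m
  ... | inj₂ (c , Qc , c<m , min) = inj₂ (c , Qc , m<n⇒m<1+n c<m , min)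
  ... | inj₁ none with Q? m
  ...   | yes Qm = inj₂ (m , Qm , n<1+n m , none)
  ...   | no ¬Qm = inj₁ (none-below-suc none ¬Qm)

  last-below : ∀ m → (∀ j → j < m → ¬ Q j)
             ⊎ ∃ λ c → Q c × c < m × (∀ j → j < m → Q j → j ≤ c)
  last-below zero = inj₁ λ _ ()
  last-below (suc m) with Q? m
  ... | yes Qm = inj₂ (m , Qm , n<1+n m , λ _ j<1+m _ → m<1+n⇒m≤n j<1+m)
  ... | no ¬Qm with last-below m
  ...   | inj₁ none = inj₁ (none-below-suc none ¬Qm)
  ...   | inj₂ (c , Qc , c<m , max) = inj₂ (c , Qc , m<n⇒m<1+n c<m , max′)
    where
    max′ : ∀ j → j < suc m → Q j → j ≤ c
    max′ j j<1+m Qj = max j (≤∧≢⇒< (m<1+n⇒m≤n j<1+m) λ { refl → ¬Qm Qj }) Qj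

  least : ∀ {b} → Q b → ∃ λ c → Q c × (∀ j → j < c → ¬ Q j)
  least {b} Qb with first-below (suc b)
  ... | inj₁ none = ⊥-elim (none b (n<1+n b) Qb)
  ... | inj₂ (c , Qc , _ , min) = c , Qc , min

offset-suc : ∀ a {x y x′ y′} → x′ ≡ a + x → y′ ≡ a + y → (y′ ≡ suc x′) ⇔ (y ≡ suc x)
offset-suc a {x} refl refl = mk⇔
  (λ e → +-cancelˡ-≡ a _ _ (trans e (≡.sym (+-suc a x))))
  (λ e → trans (cong (a +_) e) (+-suc a x))

slice : ∀ {L k} a → a + L ≤ k → Fin L → Fin k
slice a a+L≤k s = inject≤ (a ↑ʳ s) a+L≤k

toℕ-slice : ∀ {L k} a (a+L≤k : a + L ≤ k) s → toℕ (slice a a+L≤k s) ≡ a + toℕ s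
toℕ-slice a a+L≤k s = trans (toℕ-inject≤ (a ↑ʳ s) a+L≤k) (toℕ-↑ʳ a s)

slice-injective : ∀ {L k} a (a+L≤k : a + L ≤ k) → Injective _≡_ _≡_ (slice a a+L≤k)
slice-injective a a+L≤k {s} {t} e = toℕ-injective (+-cancelˡ-≡ a _ _
  (trans (≡.sym (toℕ-slice a a+L≤k s)) (trans (cong toℕ e) (toℕ-slice a a+L≤k t))))

module _ {n : ℕ} (G : Graph n) where

  Consec-offset : ∀ {L K} a {i j : Fin L} {i′ j′ : Fin K} →
                  toℕ i′ ≡ a + toℕ i → toℕ j′ ≡ a + toℕ j → Consec G i′ j′ ⇔ Consec G i j
  Consec-offset a i′≡ j′≡ = offset-suc a i′≡ j′≡ ⊎-⇔ offset-suc a j′≡ i′≡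

  slice-isInducedPath : ∀ {k L} {P : Fin k → Fin n} a (a+L≤k : a + L ≤ k) →
                        IsInducedPath G k P → IsInducedPath G L (P ∘ slice a a+L≤k)
  slice-isInducedPath a a+L≤k (P-injective , P-adj) =
    slice-injective a a+L≤k ∘ P-injective ,
    λ s t → Consec-offset a (toℕ-slice a a+L≤k s) (toℕ-slice a a+L≤k t)
            ⇔-∘ P-adj (slice a a+L≤k s) (slice a a+L≤k t)

  CycConsec-sym : ∀ {L} {i j : Fin L} → CycConsec G i j → CycConsec G j i
  CycConsec-sym = [ inj₁ ∘ swap , inj₂ ∘ swap ]

  CycConsec-suc : ∀ {L} {i j : Fin L} → CycConsec G (suc i) (suc j) ⇔ Consec G i j
  CycConsec-suc = mk⇔
    (λ { (inj₁ c) → to (Consec-offset 1 refl refl) c ; (inj₂ (inj₁ (_ , ()))) ; (inj₂ (inj₂ (_ , ()))) })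
    (inj₁ ∘ from (Consec-offset 1 refl refl))

  CycConsec-apex : ∀ {m} (s : Fin (2 + m)) →
                   CycConsec G {3 + m} zero (suc s) ⇔ (toℕ s ≡ 0 ⊎ toℕ s ≡ suc m)
  CycConsec-apex s = mk⇔
    (λ { (inj₁ (inj₁ e)) → inj₁ (suc-injective e)
       ; (inj₁ (inj₂ ()))
       ; (inj₂ (inj₁ (() , _)))
       ; (inj₂ (inj₂ (e , _))) → inj₂ (suc-injective (suc-injective e)) })
    [ inj₁ ∘ inj₁ ∘ cong ℕ.suc , (λ e → inj₂ (inj₂ (cong (ℕ.suc ∘ ℕ.suc) e , refl))) ]

  cone-isInducedCycle : ∀ {m} {Q : Fin (2 + m) → Fin n} {v : Fin n} →
                        IsInducedPath G (2 + m) Q → (∀ s → Q s ≢ v) →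
                        (∀ s → Adj G v (Q s) ⇔ (toℕ s ≡ 0 ⊎ toℕ s ≡ suc m)) →
                        IsInducedCycle G (3 + m) (v ∷ Q)
  cone-isInducedCycle {Q = Q} {v} (Q-injective , Q-adj) v∉Q v-adj =
    s≤s (s≤s (s≤s z≤n)) , injective , adj
    where
    injective : Injective _≡_ _≡_ (v ∷ Q)
    injective {zero}  {zero}  _ = refl
    injective {zero}  {suc t} e = ⊥-elim (v∉Q t (≡.sym e))
    injective {suc s} {zero}  e = ⊥-elim (v∉Q s e)
    injective {suc s} {suc t} e = cong suc (Q-injective e)

    apex-adj : ∀ s → Adj G v (Q s) ⇔ CycConsec G zero (suc s)
    apex-adj s = ⇔-sym (CycConsec-apex s) ⇔-∘ v-adj s

    adj : ∀ i j → Adj G ((v ∷ Q) i) ((v ∷ Q) j) ⇔ CycConsec G i j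
    adj zero    zero    = mk⇔ (⊥-elim ∘ irrefl G)
      λ { (inj₁ (inj₁ ())) ; (inj₁ (inj₂ ())) ; (inj₂ (inj₁ (() , _))) ; (inj₂ (inj₂ (() , _))) }
    adj zero    (suc t) = apex-adj t
    adj (suc s) zero    = mk⇔ (CycConsec-sym ∘ to (apex-adj s) ∘ sym G)
                              (sym G ∘ from (apex-adj s) ∘ CycConsec-sym)
    adj (suc s) (suc t) = ⇔-sym CycConsec-suc ⇔-∘ Q-adj s t

module Neighbours {n : ℕ} (G : Graph n) {k : ℕ} (P : Fin k → Fin n) (v : Fin n) where

  NbrAt : ℕ → Set
  NbrAt j = ∃ λ (x : Fin k) → toℕ x ≡ j × Adj G v (P x)

  nbrAt? : ∀ j → Dec (NbrAt j)
  nbrAt? j = any? λ x → (toℕ x ≟ j) ×-dec adj? G v (P x)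

  NbrAt<k : ∀ {j} → NbrAt j → j < k
  NbrAt<k (x , refl , _) = toℕ<n x

  NbrAt⇒Adj : ∀ {x : Fin k} {j} → toℕ x ≡ j → NbrAt j → Adj G v (P x)
  NbrAt⇒Adj x≡j (y , y≡j , adj) = subst (Adj G v ∘ P) (toℕ-injective (trans y≡j (≡.sym x≡j))) adj

  neighbourhood-window : ∀ B → (∀ {a b} → NbrAt a → NbrAt b → b < a + B) →
    Σ ℕ λ i → Σ ℕ λ ℓ →
      i + ℓ ≤ k
    × ℓ ≤ B
    × (∀ j → Adj G v (P j) → (i ≤ toℕ j × toℕ j < i + ℓ))
    × (0 < ℓ → ∀ j → toℕ j ≡ i → Adj G v (P j))
    × (0 < ℓ → ∀ j → suc (toℕ j) ≡ i + ℓ → Adj G v (P j))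
  neighbourhood-window B spread with last-below nbrAt? k
  ... | inj₁ none =
    0 , 0 , z≤n , z≤n , (λ j adj → ⊥-elim (none (toℕ j) (toℕ<n j) (j , refl , adj))) , (λ ()) , (λ ())
  ... | inj₂ (l , Nl , l<k , l-max) with least nbrAt? Nl
  ...   | f , Nf , f-min =
    f , suc l ∸ f , subst (_≤ k) (≡.sym f+ℓ≡1+l) l<k , ℓ≤B , within ,
    (λ _ j j≡f → NbrAt⇒Adj j≡f Nf) ,
    (λ _ j 1+j≡f+ℓ → NbrAt⇒Adj (suc-injective (trans 1+j≡f+ℓ f+ℓ≡1+l)) Nl)
    where
    f+ℓ≡1+l : f + (suc l ∸ f) ≡ suc l
    f+ℓ≡1+l = m+[n∸m]≡n (m≤n⇒m≤1+n (≮⇒≥ λ l<f → f-min l l<f Nl))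

    ℓ≤B : suc l ∸ f ≤ B
    ℓ≤B = subst (suc l ∸ f ≤_) (m+n∸m≡n f B) (∸-monoˡ-≤ f (spread Nf Nl))

    within : ∀ j → Adj G v (P j) → f ≤ toℕ j × toℕ j < f + (suc l ∸ f)
    within j adj = ≮⇒≥ (λ j<f → f-min (toℕ j) j<f (j , refl , adj)) ,
                   subst (toℕ j <_) (≡.sym f+ℓ≡1+l) (s≤s (l-max (toℕ j) (toℕ<n j) (j , refl , adj)))

a+2[1+r]q≡a+q+q+2rq : ∀ a r q → a + 2 * suc r * q ≡ a + q + q + 2 * r * q
a+2[1+r]q≡a+q+q+2rq = solve-∀

module _ {n : ℕ} (G : Graph n) {k : ℕ} {P : Fin k → Fin n} (P-induced : IsInducedPath G k P)
         (v : Fin n) (v∉P : ∀ j → P j ≢ v) where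

  open Neighbours G P v

  private
    P-injective : Injective _≡_ _≡_ P
    P-injective = proj₁ P-induced

    P-adj : ∀ i j → Adj G (P i) (P j) ⇔ Consec G i j
    P-adj = proj₂ P-induced

  nbr-hole : ∀ a m → NbrAt a → NbrAt (a + suc m) → (∀ j → a < j → j < a + suc m → ¬ NbrAt j) →
             ∃ λ C → IsInducedCycle G (3 + m) C
  nbr-hole a m Na Nb free =
    v ∷ P ∘ slice a fits ,
    cone-isInducedCycle G (slice-isInducedPath G a fits P-induced) (v∉P ∘ slice a fits) v-adj
    where
    fits : a + (2 + m) ≤ k
    fits = subst (_≤ k) (≡.sym (+-suc a (suc m))) (NbrAt<k Nb)

    v-adj : ∀ s → Adj G v (P (slice a fits s)) ⇔ (toℕ s ≡ 0 ⊎ toℕ s ≡ suc m)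
    v-adj s = mk⇔ ends-only
      [ (λ s≡0 → NbrAt⇒Adj (trans (toℕ-slice a fits s) (trans (cong (a +_) s≡0) (+-identityʳ a))) Na)
      , (λ s≡1+m → NbrAt⇒Adj (trans (toℕ-slice a fits s) (cong (a +_) s≡1+m)) Nb) ]
      where
      ends-only : Adj G v (P (slice a fits s)) → toℕ s ≡ 0 ⊎ toℕ s ≡ suc m
      ends-only adj with toℕ s ≟ 0 | toℕ s ≟ suc m
      ... | yes s≡0 | _       = inj₁ s≡0
      ... | no _    | yes s≡1+m = inj₂ s≡1+m
      ... | no s≢0  | no s≢1+m = ⊥-elim (free (a + toℕ s)
              (m<m+n a (n≢0⇒n>0 s≢0))
              (+-monoʳ-< a (≤∧≢⇒< (m<1+n⇒m≤n (toℕ<n s)) s≢1+m))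
              (slice a fits s , toℕ-slice a fits s , adj))

  Apart : Fin k → Fin k → Set
  Apart x y = suc (toℕ x) < toℕ y ⊎ suc (toℕ y) < toℕ x

  apart⇒≢ : ∀ {x y} → Apart x y → x ≢ y
  apart⇒≢ apart refl = [ x≮x , x≮x ] apart
    where
    x≮x : ∀ {x} → suc x < x → ⊥
    x≮x 1+x<x = <-irrefl refl (<-trans (n<1+n _) 1+x<x)

  apart⇒¬Consec : ∀ {x y} → Apart x y → ¬ Consec G x y
  apart⇒¬Consec = [ far⇒¬Consec , (λ 1+y<x → far⇒¬Consec 1+y<x ∘ swap) ]
    where
    far⇒¬Consec : ∀ {x y : Fin k} → suc (toℕ x) < toℕ y → ¬ Consec G x y
    far⇒¬Consec 1+x<y (inj₁ y≡1+x) = <-irrefl (≡.sym y≡1+x) 1+x<y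
    far⇒¬Consec 1+x<y (inj₂ x≡1+y) =
      <-asym (<-trans (n<1+n _) 1+x<y) (subst (_ <_) (≡.sym x≡1+y) (n<1+n _))

  ApartNbrs : ℕ → ℕ → Set
  ApartNbrs r a = Σ (Fin (suc r) → Fin k) λ g →
                    (∀ i → Adj G v (P (g i)))
                  × (∀ i → a ≤ toℕ (g i))
                  × (∀ i j → i ≢ j → Apart (g i) (g j))

  ApartNbrs-∷ : ∀ {r a e} (x : Fin k) → toℕ x ≡ a → Adj G v (P x) → suc a < e →
                ApartNbrs r e → ApartNbrs (suc r) a
  ApartNbrs-∷ {a = a} x x≡a x-adj 1+a<e (g , g-adj , g-above , g-apart) =
    x ∷ g , adj , above , apart
    where
    x-below : ∀ i → suc (toℕ x) < toℕ (g i)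
    x-below i = subst (λ y → suc y < toℕ (g i)) (≡.sym x≡a) (<-≤-trans 1+a<e (g-above i))

    adj : ∀ i → Adj G v (P ((x ∷ g) i))
    adj zero    = x-adj
    adj (suc i) = g-adj i

    above : ∀ i → a ≤ toℕ ((x ∷ g) i)
    above zero    = ≤-reflexive (≡.sym x≡a)
    above (suc i) = ≤-trans (≤-trans (n≤1+n a) (<⇒≤ 1+a<e)) (g-above i)

    apart : ∀ i j → i ≢ j → Apart ((x ∷ g) i) ((x ∷ g) j)
    apart zero    zero    i≢j = ⊥-elim (i≢j refl)
    apart zero    (suc j) _   = inj₁ (x-below j)
    apart (suc i) zero    _   = inj₂ (x-below i)
    apart (suc i) (suc j) i≢j = g-apart i j (i≢j ∘ cong suc)

  claw-free⇒¬ApartNbrs : ∀ {r a} → K1-Free G (suc r) → ¬ ApartNbrs r a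
  claw-free⇒¬ApartNbrs claw-free (g , g-adj , _ , g-apart) =
    claw-free (v , P ∘ g , injective , g-adj , nonadjacent)
    where
    injective : Injective _≡_ _≡_ (P ∘ g)
    injective {i} {j} e with i Finₚ.≟ j
    ... | yes i≡j = i≡j
    ... | no i≢j  = ⊥-elim (apart⇒≢ (g-apart i j i≢j) (P-injective e))

    nonadjacent : ∀ i j → i ≢ j → ¬ Adj G (P (g i)) (P (g j))
    nonadjacent i j i≢j = apart⇒¬Consec (g-apart i j i≢j) ∘ to (P-adj (g i) (g j))

  module _ {q₂ : ℕ} (1≤q₂ : 1 ≤ q₂) (no-hole : NoLongInducedHole G (2 + q₂)) where

    next-nbr-gap : ∀ {a c} → NbrAt a → NbrAt c → a < c → (∀ j → a < j → j < c → ¬ NbrAt j) →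
                   c ≤ a + q₂
    next-nbr-gap {a} {c} Na Nc a<c free with c ≤? a + q₂
    ... | yes c≤a+q₂ = c≤a+q₂
    ... | no c≰a+q₂ =
      let C , C-hole = nbr-hole a m Na (subst NbrAt (≡.sym a+1+m≡c) Nc)
                         (λ j a<j j<a+1+m → free j a<j (subst (j <_) a+1+m≡c j<a+1+m))
      in ⊥-elim (no-hole (3 + m) C (s≤s (s≤s (m≤n⇒m≤1+n q₂≤m))) C-hole)
      where
      m : ℕ
      m = c ∸ suc a
      a+1+m≡c : a + suc m ≡ c
      a+1+m≡c = trans (+-suc a m) (m+[n∸m]≡n a<c)
      q₂≤m : q₂ ≤ m
      q₂≤m = +-cancelˡ-≤ a _ _
               (m<1+n⇒m≤n (subst (a + q₂ <_) (≡.sym (m+[n∸m]≡n a<c)) (≰⇒> c≰a+q₂)))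

    next-nbr : ∀ {a b} → NbrAt a → NbrAt b → a < b → ∃ λ c → NbrAt c × a < c × c ≤ a + q₂
    next-nbr {a} Na Nb a<b =
      let c , (a<c , Nc) , c-min = least (λ j → (a <? j) ×-dec nbrAt? j) (a<b , Nb)
      in c , Nc , a<c , next-nbr-gap Na Nc a<c (λ j a<j j<c Nj → c-min j j<c (a<j , Nj))

    second-next-nbr : ∀ {a b} → NbrAt a → NbrAt b → a + q₂ + q₂ ≤ b →
                      ∃ λ e → NbrAt e × suc a < e × e ≤ a + q₂ + q₂
    second-next-nbr {a} Na Nb a+2q₂≤b =
      let c , Nc , a<c , c≤a+q₂ =
            next-nbr Na Nb (<-≤-trans (m<m+n a 1≤q₂) (≤-trans (m≤m+n _ _) a+2q₂≤b))
          e , Ne , c<e , e≤c+q₂ =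
            next-nbr Nc Nb (≤-<-trans c≤a+q₂ (<-≤-trans (m<m+n _ 1≤q₂) a+2q₂≤b))
      in e , Ne , ≤-<-trans a<c c<e , ≤-trans e≤c+q₂ (+-monoˡ-≤ q₂ c≤a+q₂)

    apart-nbrs : ∀ r {a b} → NbrAt a → NbrAt b → a + 2 * r * q₂ ≤ b → ApartNbrs r a
    apart-nbrs zero (x , x≡a , x-adj) _ _ =
      (λ _ → x) , (λ _ → x-adj) , (λ _ → ≤-reflexive (≡.sym x≡a)) ,
      λ { zero zero 0≢0 → ⊥-elim (0≢0 refl) }
    apart-nbrs (suc r) {a} {b} Na@(x , x≡a , x-adj) Nb a+2[1+r]q₂≤b =
      let e , Ne , 1+a<e , e≤a+2q₂ = second-next-nbr Na Nb (m+n≤o⇒m≤o (a + q₂ + q₂) bound)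
      in ApartNbrs-∷ x x≡a x-adj 1+a<e
           (apart-nbrs r Ne Nb (≤-trans (+-monoˡ-≤ (2 * r * q₂) e≤a+2q₂) bound))
      where
      bound : a + q₂ + q₂ + 2 * r * q₂ ≤ b
      bound = subst (_≤ b) (a+2[1+r]q≡a+q+q+2rq a r q₂) a+2[1+r]q₂≤b

    nbr-distance : ∀ {d′} → K1-Free G (suc d′) → ∀ {a b} → NbrAt a → NbrAt b → b < a + 2 * d′ * q₂
    nbr-distance {d′} claw-free Na Nb = ≰⇒> (claw-free⇒¬ApartNbrs claw-free ∘ apart-nbrs d′ Na Nb)

lemma4p5 : ∀ {n : ℕ} (G : Graph n) (d q : ℕ) → 1 ≤ d → 3 ≤ q
    → Connected G → K1-Free G d → NoLongInducedHole G q
    → (k : ℕ) (P : Fin k → Fin n) → IsInducedPath G k P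
    → (v : Fin n) → (∀ j → P j ≢ v)
    → Σ ℕ λ i → Σ ℕ λ ℓ →
        i + ℓ ≤ k
      × ℓ ≤ 2 * (d ∸ 1) * (q ∸ 2)
      × (∀ j → Adj G v (P j) → (i ≤ toℕ j × toℕ j < i + ℓ))
      × (0 < ℓ → ∀ j → toℕ j ≡ i → Adj G v (P j))
      × (0 < ℓ → ∀ j → suc (toℕ j) ≡ i + ℓ → Adj G v (P j))
lemma4p5 G zero _ () _ _ _ _ _ _ _ _ _
lemma4p5 G (suc d′) (suc (suc q₂)) _ (s≤s (s≤s 1≤q₂)) _ claw-free no-hole k P P-induced v v∉P =
  Neighbours.neighbourhood-window G P v (2 * d′ * q₂)
    (nbr-distance G P-induced v v∉P 1≤q₂ no-hole claw-free)
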